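{- Let $H$ be a finite simple undirected graph with $|V(H)|\ge 2$ and diameter at most $2$, and let $G$ be the graph constructed from $H$ as described in the context. If $VC$ is a vertex cover of $H$, then $M = VC\cup L''\cup\{v_*'\}$ is a monitoring edge-geodetic set of $G$. Furthermore, if $|VC| = k$, then $|M| = k+|V(H)|+1$.
   Context: An edge $\{a,b\}$ of a graph $G$ is monitored by a pair of vertices $\{x,y\}$ if $\{a,b\}$ lies on every shortest path from $x$ to $y$ in $G$. A monitoring edge-geodetic set (MEG-set) of $G$ is a set $M\subseteq V(G)$ such that every edge of $G$ is monitored by some pair $\{x,y\}$ with $x,y\in M$. Construction of $G$ from $H$: for each $v\in V(H)$ add two new vertices $v'$ and $v''$ and the edges $\{v,v'\}$ and $\{v',v''\}$; let $L'=\{v' : v\in V(H)\}$ and $L''=\{v'' : v\in V(H)\}$. Then add two further new vertices $v_*$ and $v_*'$, the edge $\{v_*,v_*'\}$, and the edges $\{v_*,v'\}$ for all $v'\in L'$. Thus $V(G)=V(H)\cup L'\cup L''\cup\{v_*,v_*'\}$ and $E(G)=E(H)\cup\{\{v,v'\}\}_{v\in V(H)}\cup\{\{v',v''\}\}_{v\in V(H)}\cup\{\{v_*,v'\}\}_{v\in V(H)}\cup\{\{v_*,v_*'\}\}$. -}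

module Defs where

open import Data.Nat using (ℕ; zero; suc; _+_; _≤_)
open import Data.Bool using (Bool; true; false)
open import Data.Fin using (Fin; zero; suc; splitAt; _≟_)
open import Data.Fin.Subset using (Subset; _∈_; inside; outside)
open import Data.Vec using (Vec; _∷_; []; _++_; replicate)
open import Data.Product using (Σ; ∃; _×_; _,_)
open import Data.Sum using (_⊎_; inj₁; inj₂)
open import Relation.Nullary using (yes; no; ¬_)
open import Relation.Nullary.Decidable using (⌊_⌋)
open import Relation.Binary.PropositionalEquality using (_≡_; refl; sym)

record SimpleGraph (n : ℕ) : Set where
  field
    adj    : Fin n → Fin n → Bool
    adj-sym    : ∀ u v → adj u v ≡ adj v u
    adj-irrefl : ∀ v → adj v v ≡ false

open SimpleGraph public

module _ {n : ℕ} (G : SimpleGraph n) where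

  Edge : Fin n → Fin n → Set
  Edge u v = adj G u v ≡ true

  data Walk : Fin n → Fin n → ℕ → Set where
    []   : ∀ {x} → Walk x x 0
    step : ∀ {x y z k} → Edge x y → Walk y z k → Walk x z (suc k)

  IsShortest : ∀ {x y k} → Walk x y k → Set
  IsShortest {x} {y} {k} _ = ∀ m → Walk x y m → k ≤ m

  data EdgeOn (a b : Fin n) : ∀ {x y k} → Walk x y k → Set where
    here₁ : ∀ {z k} (e : Edge a b) (w : Walk b z k) → EdgeOn a b (step e w)
    here₂ : ∀ {z k} (e : Edge b a) (w : Walk a z k) → EdgeOn a b (step e w)
    there : ∀ {x y z k} (e : Edge x y) {w : Walk y z k} → EdgeOn a b w → EdgeOn a b (step e w)

  Monitors : Fin n → Fin n → Fin n → Fin n → Set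
  Monitors x y a b = ∀ {k} (w : Walk x y k) → IsShortest w → EdgeOn a b w

  IsMEG : Subset n → Set
  IsMEG M = ∀ a b → Edge a b →
    Σ (Fin n) λ x → Σ (Fin n) λ y → x ∈ M × y ∈ M × Monitors x y a b

  DiamAtMost2 : Set
  DiamAtMost2 = ∀ u v → Σ ℕ λ k → k ≤ 2 × Walk u v k

  IsVertexCover : Subset n → Set
  IsVertexCover C = ∀ u v → Edge u v → u ∈ C ⊎ v ∈ C

-- The construction of G from H.
-- Vertices of G are Fin (n + (n + (n + 2))), laid out in blocks:
--   V(H) (first n), L' (next n), L'' (next n), then v_* and v_*'.

data GV (n : ℕ) : Set where
  orig prime : Fin n → GV n
  dprime : Fin n → GV n
  star star' : GV n

decode : ∀ {n} → Fin (n + (n + (n + 2))) → GV n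
decode {n} i with splitAt n i
... | inj₁ v = orig v
... | inj₂ j with splitAt n j
...   | inj₁ v = prime v
...   | inj₂ l with splitAt n l
...     | inj₁ v = dprime v
...     | inj₂ zero = star
...     | inj₂ (suc zero) = star'

eqb : ∀ {n} → Fin n → Fin n → Bool
eqb u v = ⌊ u ≟ v ⌋

module _ {n : ℕ} (H : SimpleGraph n) where

  adjGV : GV n → GV n → Bool
  adjGV (orig u)       (orig v)       = adj H u v
  adjGV (orig u)       (prime v) = eqb u v
  adjGV (prime u) (orig v)       = eqb u v
  adjGV (prime u) (dprime v)     = eqb u v
  adjGV (dprime u)     (prime v) = eqb u v
  adjGV (prime u) star           = true
  adjGV star           (prime v) = true
  adjGV star           star'          = true
  adjGV star'          star           = true
  adjGV _              _              = false

private
  eqb-sym : ∀ {n} (u v : Fin n) → eqb u v ≡ eqb v u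
  eqb-sym u v with u ≟ v | v ≟ u
  ... | yes _ | yes _ = refl
  ... | no _  | no _  = refl
  ... | yes p | no q  with q (sym p)
  ... | ()
  eqb-sym u v | no p | yes q with p (sym q)
  ... | ()

module _ {n : ℕ} (H : SimpleGraph n) where

  adjGV-sym : ∀ x y → adjGV H x y ≡ adjGV H y x
  adjGV-sym (orig u) (orig v) = adj-sym H u v
  adjGV-sym (orig u) (prime v) = eqb-sym u v
  adjGV-sym (orig u) (dprime v) = refl
  adjGV-sym (orig u) star = refl
  adjGV-sym (orig u) star' = refl
  adjGV-sym (prime u) (orig v) = eqb-sym u v
  adjGV-sym (prime u) (prime v) = refl
  adjGV-sym (prime u) (dprime v) = eqb-sym u v
  adjGV-sym (prime u) star = refl
  adjGV-sym (prime u) star' = refl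
  adjGV-sym (dprime u) (orig v) = refl
  adjGV-sym (dprime u) (prime v) = eqb-sym u v
  adjGV-sym (dprime u) (dprime v) = refl
  adjGV-sym (dprime u) star = refl
  adjGV-sym (dprime u) star' = refl
  adjGV-sym star (orig v) = refl
  adjGV-sym star (prime v) = refl
  adjGV-sym star (dprime v) = refl
  adjGV-sym star star = refl
  adjGV-sym star star' = refl
  adjGV-sym star' (orig v) = refl
  adjGV-sym star' (prime v) = refl
  adjGV-sym star' (dprime v) = refl
  adjGV-sym star' star = refl
  adjGV-sym star' star' = refl

  adjGV-irrefl : ∀ x → adjGV H x x ≡ false
  adjGV-irrefl (orig u) = adj-irrefl H u
  adjGV-irrefl (prime u) = refl
  adjGV-irrefl (dprime u) = refl
  adjGV-irrefl star = refl
  adjGV-irrefl star' = refl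

  construct : SimpleGraph (n + (n + (n + 2)))
  construct = record
    { adj = λ i j → adjGV H (decode i) (decode j)
    ; adj-sym = λ i j → adjGV-sym (decode i) (decode j)
    ; adj-irrefl = λ i → adjGV-irrefl (decode i)
    }

-- M = VC ∪ L'' ∪ {v_*'} as a subset of V(G), in the block layout above
Mset : ∀ {n} → Subset n → Subset (n + (n + (n + 2)))
Mset {n} VC = VC ++ (replicate n outside ++ (replicate n inside ++ (outside ∷ inside ∷ [])))

-- An edge {a, b} of G is monitored by {x, y} as soon as some x–y walk of length L exists and
-- every x–y walk of length at most L uses {a, b}.  The pairs doing this are
--   {u, v} ∈ E(H), u ∈ VC :  u and v''  (u v v' v'' is the only walk of length ≤ 3),
--   {u, u'}              :  u and u'' if u ∈ VC;  otherwise w and u'' for a neighbour w of u,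
--                           which lies in VC and exists because H is connected with ≥ 2 vertices,
--   {u', u''}, {u', v_*}, {v_*, v_*'} :  u'' and v_*'  (u'' u' v_* v_*' is the only such walk).
module Submission where

open import Defs
open import Data.Nat using (ℕ; suc; _+_; _≤_; s≤s)
open import Data.Nat.Properties using (+-assoc)
open import Data.Bool using (true)
open import Data.Bool.Properties using (T-≡)
open import Data.Empty using (⊥-elim)
open import Data.Fin using (Fin; zero; suc; splitAt; punchIn; fromℕ<; _↑ˡ_; _↑ʳ_)
open import Data.Fin.Properties using (splitAt-↑ˡ; splitAt-↑ʳ; splitAt⁻¹-↑ˡ; splitAt⁻¹-↑ʳ; punchInᵢ≢i)
open import Data.Fin.Subset using (Subset; ∣_∣; _∈_; inside; outside; ⊥; ⊤)
open import Data.Fin.Subset.Properties using (∈⊤; ∣⊥∣≡0; ∣⊤∣≡n)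
open import Data.Product using (Σ; _×_; _,_; proj₁; proj₂; map)
open import Data.Sum using (inj₁; inj₂)
open import Data.Vec using ([]; _∷_; _++_; here; there)
open import Data.Vec.Properties using (lookup-++ˡ; lookup-++ʳ; lookup⇒[]=; []=⇒lookup)
open import Function using (_∘_; _↔_; Inverse; Injection)
open import Function.Bundles using (mk↔ₛ′; Equivalence)
open import Function.Properties.Inverse using (↔⇒↣)
open import Relation.Nullary using (¬_)
open import Relation.Nullary.Decidable using (toWitness; fromWitness)
open import Relation.Binary.PropositionalEquality

∈-++⁺ˡ : ∀ {m k} {p : Subset m} (q : Subset k) {x} → x ∈ p → (x ↑ˡ k) ∈ (p ++ q)
∈-++⁺ˡ {p = p} q {x} x∈p = lookup⇒[]= _ _ (trans (lookup-++ˡ p q x) ([]=⇒lookup x∈p))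

∈-++⁺ʳ : ∀ {m k} (p : Subset m) {q : Subset k} {x} → x ∈ q → (m ↑ʳ x) ∈ (p ++ q)
∈-++⁺ʳ p {q} {x} x∈q = lookup⇒[]= _ _ (trans (lookup-++ʳ p q x) ([]=⇒lookup x∈q))

∣p++q∣≡∣p∣+∣q∣ : ∀ {m k} (p : Subset m) (q : Subset k) → ∣ p ++ q ∣ ≡ ∣ p ∣ + ∣ q ∣
∣p++q∣≡∣p∣+∣q∣ []            q = refl
∣p++q∣≡∣p∣+∣q∣ (inside ∷ p)  q = cong suc (∣p++q∣≡∣p∣+∣q∣ p q)
∣p++q∣≡∣p∣+∣q∣ (outside ∷ p) q = ∣p++q∣≡∣p∣+∣q∣ p q

first-edge : ∀ {n} (H : SimpleGraph n) {u v k} → Walk H u v k → ¬ u ≡ v → Σ (Fin n) (Edge H u)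
first-edge H []         u≢u = ⊥-elim (u≢u refl)
first-edge H (step e _) _   = _ , e

has-neighbour : ∀ {n} (H : SimpleGraph n) → 2 ≤ n → (∀ u v → Σ ℕ (Walk H u v)) →
                ∀ u → Σ (Fin n) (Edge H u)
has-neighbour H (s≤s (s≤s _)) connected u =
  first-edge H (proj₂ (connected u (punchIn u zero))) (punchInᵢ≢i u zero ∘ sym)

module WalksOn {A : Set} (E : A → A → Set) where

  data Path : A → A → ℕ → Set where
    []   : ∀ {x} → Path x x 0
    step : ∀ {x y z k} → E x y → Path y z k → Path x z (suc k)

  data Crosses (a b : A) : ∀ {x z k} → Path x z k → Set where
    here  : ∀ {x y z k} {e : E x y} {w : Path y z k} → x ≡ a → y ≡ b → Crosses a b (step e w)
    here⁻ : ∀ {x y z k} {e : E x y} {w : Path y z k} → x ≡ b → y ≡ a → Crosses a b (step e w)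
    there : ∀ {x y z k} {e : E x y} {w : Path y z k} → Crosses a b w → Crosses a b (step e w)

  crosses-sym : ∀ {a b x z k} {w : Path x z k} → Crosses a b w → Crosses b a w
  crosses-sym (here p q)  = here⁻ p q
  crosses-sym (here⁻ p q) = here p q
  crosses-sym (there c)   = there (crosses-sym c)

  record MonitoringPair (S : A → Set) (a b : A) : Set where
    constructor monitoredBy
    field
      {source target} : A
      {length}        : ℕ
      source∈S        : S source
      target∈S        : S target
      witness         : Path source target length
      crossing        : ∀ {k} (w : Path source target k) → k ≤ length → Crosses a b w

  monitoringPair-sym : ∀ {S a b} → MonitoringPair S a b → MonitoringPair S b a
  monitoringPair-sym (monitoredBy s∈S t∈S witness crossing) =
    monitoredBy s∈S t∈S witness (λ w k≤L → crosses-sym (crossing w k≤L))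

-- Walks of G are analysed on an isomorphic copy whose vertex type, unlike Fin m, can be pattern
-- matched on.
module Transport {m} (G : SimpleGraph m) {A : Set} (E : A → A → Set) (ι : Fin m ↔ A)
                 (edge⇒E : ∀ {i j} → Edge G i j → E (Inverse.to ι i) (Inverse.to ι j))
                 (E⇒edge : ∀ {a b} → E a b → Edge G (Inverse.from ι a) (Inverse.from ι b)) where

  open Inverse ι using (to; from; strictlyInverseˡ)
  open WalksOn E

  to-injective : ∀ {i j} → to i ≡ to j → i ≡ j
  to-injective = Injection.injective (↔⇒↣ ι)

  toPath : ∀ {i j k} → Walk G i j k → Path (to i) (to j) k
  toPath []         = []
  toPath (step e w) = step (edge⇒E e) (toPath w)

  fromPath : ∀ {a b k} → Path a b k → Walk G (from a) (from b) k
  fromPath []         = []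
  fromPath (step e w) = step (E⇒edge e) (fromPath w)

  crosses⇒EdgeOn : ∀ {a b i j k} (w : Walk G i j k) → Crosses (to a) (to b) (toPath w) →
                   EdgeOn G a b w
  crosses⇒EdgeOn (step e w) (here p q)  with refl ← to-injective p | refl ← to-injective q = here₁ e w
  crosses⇒EdgeOn (step e w) (here⁻ p q) with refl ← to-injective p | refl ← to-injective q = here₂ e w
  crosses⇒EdgeOn (step e w) (there c)   = there e (crosses⇒EdgeOn w c)

  monitors : ∀ {s t L i j} → Path s t L → (∀ {k} (w : Path s t k) → k ≤ L → Crosses (to i) (to j) w) →
             Monitors G (from s) (from t) i j
  monitors {s} {t} {L} {i} {j} witness crossing w shortest =
    crosses⇒EdgeOn w
      (crossing′ (strictlyInverseˡ s) (strictlyInverseˡ t) (toPath w) (shortest L (fromPath witness)))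
    where
    crossing′ : ∀ {s′ t′ k} → s′ ≡ s → t′ ≡ t → (w : Path s′ t′ k) → k ≤ L → Crosses (to i) (to j) w
    crossing′ refl refl = crossing

  isMEG : ∀ {M} → (∀ {a b} → E a b → MonitoringPair (λ a → from a ∈ M) a b) → IsMEG G M
  isMEG pair i j e with pair (edge⇒E e)
  ... | monitoredBy s∈M t∈M witness crossing = _ , _ , s∈M , t∈M , monitors witness crossing

eqb⇒≡ : ∀ {n} (u v : Fin n) → eqb u v ≡ true → u ≡ v
eqb⇒≡ u v = toWitness ∘ Equivalence.from T-≡

eqb-refl : ∀ {n} (u : Fin n) → eqb u u ≡ true
eqb-refl u = Equivalence.to T-≡ (fromWitness refl)

encode : ∀ {n} → GV n → Fin (n + (n + (n + 2)))
encode {n} (orig u)   = u ↑ˡ (n + (n + 2))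
encode {n} (prime u)  = n ↑ʳ (u ↑ˡ (n + 2))
encode {n} (dprime u) = n ↑ʳ (n ↑ʳ (u ↑ˡ 2))
encode {n} star       = n ↑ʳ (n ↑ʳ (n ↑ʳ zero))
encode {n} star'      = n ↑ʳ (n ↑ʳ (n ↑ʳ suc zero))

encode-decode : ∀ {n} (i : Fin (n + (n + (n + 2)))) → encode {n} (decode {n} i) ≡ i
encode-decode {n} i with splitAt n i in eq
... | inj₁ v with refl ← splitAt⁻¹-↑ˡ eq = refl
... | inj₂ j with refl ← splitAt⁻¹-↑ʳ eq with splitAt n j in eq₂
...   | inj₁ v with refl ← splitAt⁻¹-↑ˡ eq₂ = refl
...   | inj₂ l with refl ← splitAt⁻¹-↑ʳ eq₂ with splitAt n l in eq₃
...     | inj₁ v          with refl ← splitAt⁻¹-↑ˡ eq₃ = refl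
...     | inj₂ zero       with refl ← splitAt⁻¹-↑ʳ eq₃ = refl
...     | inj₂ (suc zero) with refl ← splitAt⁻¹-↑ʳ eq₃ = refl

decode-encode : ∀ {n} (x : GV n) → decode (encode x) ≡ x
decode-encode {n} (orig u)
  rewrite splitAt-↑ˡ n u (n + (n + 2)) = refl
decode-encode {n} (prime u)
  rewrite splitAt-↑ʳ n (n + (n + 2)) (u ↑ˡ (n + 2)) | splitAt-↑ˡ n u (n + 2) = refl
decode-encode {n} (dprime u)
  rewrite splitAt-↑ʳ n (n + (n + 2)) (n ↑ʳ (u ↑ˡ 2)) | splitAt-↑ʳ n (n + 2) (u ↑ˡ 2)
        | splitAt-↑ˡ n u 2 = refl
decode-encode {n} star
  rewrite splitAt-↑ʳ n (n + (n + 2)) (n ↑ʳ (n ↑ʳ zero)) | splitAt-↑ʳ n (n + 2) (n ↑ʳ zero)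
        | splitAt-↑ʳ n 2 zero = refl
decode-encode {n} star'
  rewrite splitAt-↑ʳ n (n + (n + 2)) (n ↑ʳ (n ↑ʳ suc zero)) | splitAt-↑ʳ n (n + 2) (n ↑ʳ suc zero)
        | splitAt-↑ʳ n 2 (suc zero) = refl

Fin↔GV : ∀ {n} → Fin (n + (n + (n + 2))) ↔ GV n
Fin↔GV {n} = mk↔ₛ′ decode encode (decode-encode {n}) (encode-decode {n})

orig∈Mset : ∀ {n} (VC : Subset n) {u} → u ∈ VC → encode (orig u) ∈ Mset VC
orig∈Mset {n} VC = ∈-++⁺ˡ (⊥ {n} ++ (⊤ {n} ++ (outside ∷ inside ∷ [])))

dprime∈Mset : ∀ {n} (VC : Subset n) (u : Fin n) → encode (dprime u) ∈ Mset VC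
dprime∈Mset {n} VC u = ∈-++⁺ʳ VC (∈-++⁺ʳ (⊥ {n}) (∈-++⁺ˡ (outside ∷ inside ∷ []) ∈⊤))

star'∈Mset : ∀ {n} (VC : Subset n) → encode {n} star' ∈ Mset VC
star'∈Mset {n} VC = ∈-++⁺ʳ VC (∈-++⁺ʳ (⊥ {n}) (∈-++⁺ʳ (⊤ {n}) (there here)))

∣Mset∣ : ∀ {n} (VC : Subset n) → ∣ Mset VC ∣ ≡ ∣ VC ∣ + n + 1
∣Mset∣ {n} VC = begin
  ∣ VC ++ (L′ ++ (L″ ++ stars)) ∣
    ≡⟨ trans (∣p++q∣≡∣p∣+∣q∣ VC (L′ ++ (L″ ++ stars))) (cong (∣ VC ∣ +_)
         (trans (∣p++q∣≡∣p∣+∣q∣ L′ (L″ ++ stars)) (cong (∣ L′ ∣ +_) (∣p++q∣≡∣p∣+∣q∣ L″ stars)))) ⟩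
  ∣ VC ∣ + (∣ L′ ∣ + (∣ L″ ∣ + 1))
    ≡⟨ cong₂ (λ a b → ∣ VC ∣ + (a + (b + 1))) (∣⊥∣≡0 n) (∣⊤∣≡n n) ⟩
  ∣ VC ∣ + (n + 1)
    ≡⟨ +-assoc ∣ VC ∣ n 1 ⟨
  ∣ VC ∣ + n + 1
    ∎
  where
  open ≡-Reasoning
  L′ L″ : Subset n
  L′ = ⊥
  L″ = ⊤
  stars : Subset 2
  stars = outside ∷ inside ∷ []

module _ {n} (H : SimpleGraph n) where

  data Adj : GV n → GV n → Set where
    orig-orig    : ∀ {u v} → Edge H u v → Adj (orig u) (orig v)
    orig-prime   : ∀ {u} → Adj (orig u) (prime u)
    prime-orig   : ∀ {u} → Adj (prime u) (orig u)
    prime-dprime : ∀ {u} → Adj (prime u) (dprime u)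
    dprime-prime : ∀ {u} → Adj (dprime u) (prime u)
    prime-star   : ∀ {u} → Adj (prime u) star
    star-prime   : ∀ {u} → Adj star (prime u)
    star-star'   : Adj star star'
    star'-star   : Adj star' star

  adjGV⇒Adj : ∀ a b → adjGV H a b ≡ true → Adj a b
  adjGV⇒Adj (orig u)   (orig v)   e = orig-orig e
  adjGV⇒Adj (orig u)   (prime v)  e with refl ← eqb⇒≡ u v e = orig-prime
  adjGV⇒Adj (prime u)  (orig v)   e with refl ← eqb⇒≡ u v e = prime-orig
  adjGV⇒Adj (prime u)  (dprime v) e with refl ← eqb⇒≡ u v e = prime-dprime
  adjGV⇒Adj (dprime u) (prime v)  e with refl ← eqb⇒≡ u v e = dprime-prime
  adjGV⇒Adj (prime u)  star       e = prime-star
  adjGV⇒Adj star       (prime v)  e = star-prime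
  adjGV⇒Adj star       star'      e = star-star'
  adjGV⇒Adj star'      star       e = star'-star
  adjGV⇒Adj (orig _)   (dprime _) ()
  adjGV⇒Adj (orig _)   star       ()
  adjGV⇒Adj (orig _)   star'      ()
  adjGV⇒Adj (prime _)  (prime _)  ()
  adjGV⇒Adj (prime _)  star'      ()
  adjGV⇒Adj (dprime _) (orig _)   ()
  adjGV⇒Adj (dprime _) (dprime _) ()
  adjGV⇒Adj (dprime _) star       ()
  adjGV⇒Adj (dprime _) star'      ()
  adjGV⇒Adj star       (orig _)   ()
  adjGV⇒Adj star       (dprime _) ()
  adjGV⇒Adj star       star       ()
  adjGV⇒Adj star'      (orig _)   ()
  adjGV⇒Adj star'      (prime _)  ()
  adjGV⇒Adj star'      (dprime _) ()
  adjGV⇒Adj star'      star'      ()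

  Adj⇒adjGV : ∀ {a b} → Adj a b → adjGV H a b ≡ true
  Adj⇒adjGV (orig-orig e)     = e
  Adj⇒adjGV (orig-prime {u})   = eqb-refl u
  Adj⇒adjGV (prime-orig {u})   = eqb-refl u
  Adj⇒adjGV (prime-dprime {u}) = eqb-refl u
  Adj⇒adjGV (dprime-prime {u}) = eqb-refl u
  Adj⇒adjGV prime-star         = refl
  Adj⇒adjGV star-prime         = refl
  Adj⇒adjGV star-star'         = refl
  Adj⇒adjGV star'-star         = refl

  edge⇒Adj : ∀ {i j} → Edge (construct H) i j → Adj (decode i) (decode j)
  edge⇒Adj {i} {j} = adjGV⇒Adj (decode i) (decode j)

  Adj⇒edge : ∀ {a b} → Adj a b → Edge (construct H) (encode a) (encode b)
  Adj⇒edge {a} {b} e rewrite decode-encode a | decode-encode b = Adj⇒adjGV e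

  open WalksOn Adj
  open Transport (construct H) Adj Fin↔GV edge⇒Adj Adj⇒edge using (isMEG)

  star→star' : ∀ {k} (w : Path star star' k) → k ≤ 1 → Crosses star star' w
  star→star' (step star-star' _) _ = here refl refl
  star→star' (step star-prime (step _ _)) (s≤s ())

  prime→star' : ∀ {u k} (w : Path (prime u) star' k) → k ≤ 2 →
                Crosses (prime u) star w × Crosses star star' w
  prime→star' (step prime-star w) (s≤s k≤1) = here refl refl , there (star→star' w k≤1)
  prime→star' (step prime-orig (step _ (step _ _))) (s≤s (s≤s ()))
  prime→star' (step prime-dprime (step _ (step _ _))) (s≤s (s≤s ()))

  dprime→star' : ∀ {u k} (w : Path (dprime u) star' k) → k ≤ 3 →
                 Crosses (dprime u) (prime u) w × Crosses (prime u) star w × Crosses star star' w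
  dprime→star' (step dprime-prime w) (s≤s k≤2) = here refl refl , map there there (prime→star' w k≤2)

  orig→dprime : ∀ {u k} (w : Path (orig u) (dprime u) k) → k ≤ 2 → Crosses (orig u) (prime u) w
  orig→dprime (step orig-prime _) _ = here refl refl
  orig→dprime (step (orig-orig _) (step _ (step _ _))) (s≤s (s≤s ()))

  orig→dprime-neighbour : ∀ {u v k} → Edge H u v → (w : Path (orig u) (dprime v) k) → k ≤ 3 →
                          Crosses (orig u) (orig v) w × Crosses (orig v) (prime v) w
  orig→dprime-neighbour _ (step (orig-orig _) (step orig-prime (step prime-dprime []))) _ =
    here refl refl , there (here refl refl)
  orig→dprime-neighbour {u} e (step orig-prime (step prime-dprime [])) _
    with () ← trans (sym e) (adj-irrefl H u)
  orig→dprime-neighbour _ (step orig-prime (step prime-orig (step () []))) _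
  orig→dprime-neighbour _ (step orig-prime (step prime-star (step () []))) _
  orig→dprime-neighbour _ (step _ (step _ (step _ (step _ _)))) (s≤s (s≤s (s≤s ())))

  module _ (n≥2 : 2 ≤ n) (connected : ∀ u v → Σ ℕ (Walk H u v))
           {VC : Subset n} (cover : IsVertexCover H VC) where

    InMset : GV n → Set
    InMset a = encode a ∈ Mset VC

    viaNeighbour : ∀ {u v a b} → u ∈ VC → Edge H u v →
                   (∀ {k} (w : Path (orig u) (dprime v) k) → k ≤ 3 → Crosses a b w) →
                   MonitoringPair InMset a b
    viaNeighbour {v = v} u∈VC e = monitoredBy (orig∈Mset VC u∈VC) (dprime∈Mset VC v)
      (step (orig-orig e) (step orig-prime (step prime-dprime [])))

    viaStar : ∀ {a b} u → (∀ {k} (w : Path (dprime u) star' k) → k ≤ 3 → Crosses a b w) →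
              MonitoringPair InMset a b
    viaStar u = monitoredBy (dprime∈Mset VC u) (star'∈Mset VC)
      (step dprime-prime (step prime-star (step star-star' [])))

    monitoringPair : ∀ {a b} → Adj a b → MonitoringPair InMset a b
    monitoringPair (orig-orig {u} {v} e) with cover u v e
    ... | inj₁ u∈VC = viaNeighbour u∈VC e (λ w k≤3 → proj₁ (orig→dprime-neighbour e w k≤3))
    ... | inj₂ v∈VC = viaNeighbour v∈VC e′ (λ w k≤3 → crosses-sym (proj₁ (orig→dprime-neighbour e′ w k≤3)))
      where e′ = trans (adj-sym H v u) e
    monitoringPair (orig-prime {u}) with has-neighbour H n≥2 connected u
    ... | v , e with cover u v e
    ...   | inj₁ u∈VC = monitoredBy (orig∈Mset VC u∈VC) (dprime∈Mset VC u)
                          (step orig-prime (step prime-dprime [])) orig→dprime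
    ...   | inj₂ v∈VC = viaNeighbour v∈VC e′ (λ w k≤3 → proj₂ (orig→dprime-neighbour e′ w k≤3))
      where e′ = trans (adj-sym H v u) e
    monitoringPair (prime-dprime {u}) = viaStar u (λ w k≤3 → crosses-sym (proj₁ (dprime→star' w k≤3)))
    monitoringPair (prime-star {u})   = viaStar u (λ w k≤3 → proj₁ (proj₂ (dprime→star' w k≤3)))
    monitoringPair star-star'         = viaStar (fromℕ< n≥2) (λ w k≤3 → proj₂ (proj₂ (dprime→star' w k≤3)))
    monitoringPair prime-orig         = monitoringPair-sym (monitoringPair orig-prime)
    monitoringPair dprime-prime       = monitoringPair-sym (monitoringPair prime-dprime)
    monitoringPair star-prime         = monitoringPair-sym (monitoringPair prime-star)
    monitoringPair star'-star         = monitoringPair-sym (monitoringPair star-star')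

    Mset-isMEG : IsMEG (construct H) (Mset VC)
    Mset-isMEG = isMEG monitoringPair

lemma3 : (n : ℕ) (H : SimpleGraph n) → 2 ≤ n → DiamAtMost2 H →
         (VC : Subset n) → IsVertexCover H VC →
         IsMEG (construct H) (Mset VC)
           × (∀ k → ∣ VC ∣ ≡ k → ∣ Mset VC ∣ ≡ k + n + 1)
lemma3 n H n≥2 diam VC cover =
  Mset-isMEG H n≥2 connected cover , λ k ∣VC∣≡k → trans (∣Mset∣ VC) (cong (λ c → c + n + 1) ∣VC∣≡k)
  where
  connected : ∀ u v → Σ ℕ (Walk H u v)
  connected u v = let k , _ , w = diam u v in k , w
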